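{- Let $\mathcal C$ be a neural code on $[n]$, let $(\lambda,\sigma,\tau)$ be a partition of $[n]$ such that $\mathcal C$ is $(\lambda,\sigma,\tau)$-pierceable, and let $\mathcal C'$ be the corresponding piercing of $\mathcal C$. Then $T_{\mathcal C}\subseteq T_{\mathcal C'}$ (via the natural inclusion of polynomial rings).
   Context: For a neural code $\mathcal C\subseteq 2^{[n]}$ over a field $k$, let $\mathcal C^*=\mathcal C\setminus\{\varnothing\}$ and define $\phi_{\mathcal C}:k[y_c:c\in\mathcal C^*]\to k[x_1,\dots,x_n]$ by $y_c\mapsto\prod_{i\in c}x_i$; the toric ideal is $T_{\mathcal C}=\ker\phi_{\mathcal C}$. Piercing: for a partition $(\lambda,\sigma,\tau)$ of $[n]$ into three disjoint (possibly empty) sets, $\mathcal C$ is $(\lambda,\sigma,\tau)$-pierceable if $\sigma\cup\nu\in\mathcal C$ for every $\nu\subseteq\lambda$; the piercing is then the code on $[n+1]$ given by $\mathcal C'=\mathcal C\cup\{\sigma\cup\nu\cup\{n+1\}:\nu\subseteq\lambda\}$. -}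

module Defs where

open import Level using (Level; _⊔_) renaming (suc to lsuc)
open import Data.Bool using (Bool; true; false; T; _∧_; not)
open import Data.Bool.Properties using () renaming (_≟_ to _≟ᵇ_)
open import Data.Nat using (ℕ; zero; suc)
open import Data.Fin using (Fin)
import Data.Fin as F
open import Data.Fin.Subset using (Subset; inside; outside; _⊆_; _∪_; _∩_)
  renaming (⊥ to ∅; ⊤ to full)
open import Data.Fin.Subset.Properties using (anySubset?; _⊆?_)
open import Data.Vec using (Vec; []; _∷_; _∷ʳ_)
import Data.Vec
open import Data.Vec.Properties using (≡-dec)
open import Data.Product using (Σ; ∃; _×_; _,_; proj₁)
open import Data.Product.Properties using () renaming (≡-dec to ×-≡-dec)
open import Data.Sum using (_⊎_; inj₁; inj₂)
open import Relation.Nullary using (¬_; Dec; yes; no)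
open import Relation.Nullary.Decidable using (⌊_⌋; True; False; fromWitness; fromWitnessFalse; toWitnessFalse; _×-dec_; _⊎-dec_; T?)
open import Relation.Binary.PropositionalEquality using (_≡_; refl; cong)
open import Algebra.Bundles using (CommutativeRing)

record Field (c ℓ : Level) : Set (lsuc (c ⊔ ℓ)) where
  field
    commutativeRing : CommutativeRing c ℓ
  open CommutativeRing commutativeRing public
  field
    1≉0     : ¬ (1# ≈ 0#)
    inverse : ∀ x → ¬ (x ≈ 0#) → ∃ λ y → (x * y) ≈ 1#

-- The polynomial ring k[V] with variables indexed by a type V, realised
-- as the free commutative k-algebra on V: polynomial expressions modulo
-- the congruence generated by the commutative-ring axioms together with
-- the requirement that the constants form a copy of k (ring hom k → k[V]).

module Polynomials {c ℓ : Level} (k : Field c ℓ) where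
  open Field k using (Carrier; _≈_; _+_; _*_; -_; 0#; 1#)

  infixl 6 _⊕_
  infixl 7 _⊗_
  infix  8 ⊝_
  infix  4 _≈P_

  data Poly (V : Set) : Set c where
    var : V → Poly V
    con : Carrier → Poly V
    _⊕_ : Poly V → Poly V → Poly V
    _⊗_ : Poly V → Poly V → Poly V
    ⊝_  : Poly V → Poly V

  data _≈P_ {V : Set} : Poly V → Poly V → Set (c ⊔ ℓ) where
    ≈-refl   : ∀ {p} → p ≈P p
    ≈-sym    : ∀ {p q} → p ≈P q → q ≈P p
    ≈-trans  : ∀ {p q r} → p ≈P q → q ≈P r → p ≈P r
    ⊕-cong   : ∀ {p p′ q q′} → p ≈P p′ → q ≈P q′ → p ⊕ q ≈P p′ ⊕ q′
    ⊗-cong   : ∀ {p p′ q q′} → p ≈P p′ → q ≈P q′ → p ⊗ q ≈P p′ ⊗ q′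
    ⊝-cong   : ∀ {p q} → p ≈P q → ⊝ p ≈P ⊝ q
    ⊕-assoc  : ∀ p q r → (p ⊕ q) ⊕ r ≈P p ⊕ (q ⊕ r)
    ⊕-comm   : ∀ p q → p ⊕ q ≈P q ⊕ p
    ⊕-idˡ    : ∀ p → con 0# ⊕ p ≈P p
    ⊝-invˡ   : ∀ p → ⊝ p ⊕ p ≈P con 0#
    ⊗-assoc  : ∀ p q r → (p ⊗ q) ⊗ r ≈P p ⊗ (q ⊗ r)
    ⊗-comm   : ∀ p q → p ⊗ q ≈P q ⊗ p
    ⊗-idˡ    : ∀ p → con 1# ⊗ p ≈P p
    ⊗-distribʳ : ∀ p q r → (p ⊕ q) ⊗ r ≈P (p ⊗ r) ⊕ (q ⊗ r)
    con-cong : ∀ {a b} → a ≈ b → con a ≈P con b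
    con-+    : ∀ a b → con (a + b) ≈P con a ⊕ con b
    con-*    : ∀ a b → con (a * b) ≈P con a ⊗ con b
    con--    : ∀ a → con (- a) ≈P ⊝ con a

  substP : ∀ {V W : Set} → (V → Poly W) → Poly V → Poly W
  substP f (var v) = f v
  substP f (con a) = con a
  substP f (p ⊕ q) = substP f p ⊕ substP f q
  substP f (p ⊗ q) = substP f p ⊗ substP f q
  substP f (⊝ p)   = ⊝ substP f p

  rename : ∀ {V W : Set} → (V → W) → Poly V → Poly W
  rename f = substP (λ v → var (f v))

  monomial : ∀ {n} → Subset n → Poly (Fin n)
  monomial []            = con 1#
  monomial (inside  ∷ c) = var F.zero ⊗ rename F.suc (monomial c)
  monomial (outside ∷ c) = rename F.suc (monomial c)

-- Neural codes: a code on [n] is a subset of 2^[n], given by its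
-- (Bool-valued) characteristic function on codewords Subset n.

Code : ℕ → Set
Code n = Subset n → Bool

_∈ᶜ_ : ∀ {n} → Subset n → Code n → Set
w ∈ᶜ C = T (C w)

-- the index set C* = C ∖ {∅} of the variables y_c
CodeStar : ∀ {n} → Code n → Set
CodeStar {n} C = Σ (Subset n) λ w → (w ∈ᶜ C) × False (≡-dec _≟ᵇ_ w ∅)

module Toric {c ℓ : Level} (k : Field c ℓ) where
  open Field k using (Carrier; _≈_; _+_; _*_; -_; 0#; 1#)
  open Polynomials k public

  φ : ∀ {n} (C : Code n) → Poly (CodeStar C) → Poly (Fin n)
  φ C = substP (λ y → monomial (proj₁ y))

  InToric : ∀ {n} (C : Code n) → Poly (CodeStar C) → Set (c ⊔ ℓ)
  InToric C f = φ C f ≈P con 0#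

-- Partitions and piercings.  Neuron n+1 is the last coordinate of a
-- codeword in Subset (suc n), i.e. w = v ∷ʳ b with b the (n+1)-th bit.

IsPartition : ∀ {n} → Subset n → Subset n → Subset n → Set
IsPartition l s t =
  (l ∩ s ≡ ∅) × (l ∩ t ≡ ∅) × (s ∩ t ≡ ∅) × ((l ∪ s) ∪ t ≡ full)

Pierceable : ∀ {n} → Code n → Subset n → Subset n → Subset n → Set
Pierceable C l s t = ∀ ν → ν ⊆ l → (s ∪ ν) ∈ᶜ C

PiercingSet : ∀ {n} → Code n → Subset n → Subset n → Subset (suc n) → Set
PiercingSet C l s w =
  (∃ λ v → (v ∈ᶜ C) × (w ≡ v ∷ʳ outside)) ⊎
  (∃ λ ν → (ν ⊆ l) × (w ≡ (s ∪ ν) ∷ʳ inside))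

piercingSet? : ∀ {n} (C : Code n) l s (w : Subset (suc n)) → Dec (PiercingSet C l s w)
piercingSet? C l s w =
  anySubset? (λ v → T? (C v) ×-dec ≡-dec _≟ᵇ_ w (v ∷ʳ outside)) ⊎-dec
  anySubset? (λ ν → (ν ⊆? l) ×-dec ≡-dec _≟ᵇ_ w ((s ∪ ν) ∷ʳ inside))

-- the piercing C' (τ plays no role in the definition of the code)
piercing : ∀ {n} → Code n → Subset n → Subset n → Subset n → Code (suc n)
piercing C l s t w = ⌊ piercingSet? C l s w ⌋

private
  ∷ʳ-∅ : ∀ {n} (v : Subset n) → v ∷ʳ outside ≡ ∅ → v ≡ ∅
  ∷ʳ-∅ []            e = refl
  ∷ʳ-∅ (inside  ∷ v) ()
  ∷ʳ-∅ (outside ∷ v) e = cong (outside ∷_) (∷ʳ-∅ v (cong Data.Vec.tail e))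

  ∷ʳ-nonempty : ∀ {n} (v : Subset n) → False (≡-dec _≟ᵇ_ v ∅) →
                False (≡-dec _≟ᵇ_ (v ∷ʳ outside) ∅)
  ∷ʳ-nonempty v p = fromWitnessFalse (λ e → toWitnessFalse p (∷ʳ-∅ v e))

inclStar : ∀ {n} (C : Code n) l s t → CodeStar C → CodeStar (piercing C l s t)
inclStar C l s t (v , v∈C , v≢∅) =
  (v ∷ʳ outside) , fromWitness (inj₁ (v , v∈C , refl)) , ∷ʳ-nonempty v v≢∅

-- Appending an inactive neuron n+1 to a codeword does not change its monomial, so φ_{C'}
-- restricted to the variables y_c (c ∈ C*) is φ_C followed by the inclusion
-- k[x_1,…,x_n] ⊆ k[x_1,…,x_{n+1}]; a polynomial killed by φ_C is therefore killed by φ_{C'}.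
module Submission where

open import Defs
open import Level using (Level)
open import Data.Nat using (ℕ)
open import Data.Fin using (Fin; inject₁)
import Data.Fin as F
open import Data.Fin.Subset using (Subset; inside; outside)
open import Data.Vec using ([]; _∷_; _∷ʳ_)
open import Data.Product using (_,_; proj₁)
open import Function using (_∘_)
open import Relation.Binary.PropositionalEquality
  using (_≡_; refl; cong; cong₂; subst; module ≡-Reasoning)

module Substitution {c ℓ : Level} (k : Field c ℓ) where
  open Polynomials k

  substP-cong : ∀ {V W : Set} (f : V → Poly W) {p q : Poly V} →
                p ≈P q → substP f p ≈P substP f q
  substP-cong f ≈-refl              = ≈-refl
  substP-cong f (≈-sym e)           = ≈-sym (substP-cong f e)
  substP-cong f (≈-trans e e′)      = ≈-trans (substP-cong f e) (substP-cong f e′)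
  substP-cong f (⊕-cong e e′)       = ⊕-cong (substP-cong f e) (substP-cong f e′)
  substP-cong f (⊗-cong e e′)       = ⊗-cong (substP-cong f e) (substP-cong f e′)
  substP-cong f (⊝-cong e)          = ⊝-cong (substP-cong f e)
  substP-cong f (⊕-assoc p q r)     = ⊕-assoc _ _ _
  substP-cong f (⊕-comm p q)        = ⊕-comm _ _
  substP-cong f (⊕-idˡ p)           = ⊕-idˡ _
  substP-cong f (⊝-invˡ p)          = ⊝-invˡ _
  substP-cong f (⊗-assoc p q r)     = ⊗-assoc _ _ _
  substP-cong f (⊗-comm p q)        = ⊗-comm _ _
  substP-cong f (⊗-idˡ p)           = ⊗-idˡ _
  substP-cong f (⊗-distribʳ p q r)  = ⊗-distribʳ _ _ _
  substP-cong f (con-cong e)        = con-cong e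
  substP-cong f (con-+ a b)         = con-+ a b
  substP-cong f (con-* a b)         = con-* a b
  substP-cong f (con-- a)           = con-- a

  substP-ext : ∀ {V W : Set} {f g : V → Poly W} →
               (∀ v → f v ≡ g v) → ∀ p → substP f p ≡ substP g p
  substP-ext e (var v) = e v
  substP-ext e (con a) = refl
  substP-ext e (p ⊕ q) = cong₂ _⊕_ (substP-ext e p) (substP-ext e q)
  substP-ext e (p ⊗ q) = cong₂ _⊗_ (substP-ext e p) (substP-ext e q)
  substP-ext e (⊝ p)   = cong ⊝_ (substP-ext e p)

  substP-∘ : ∀ {U V W : Set} (f : U → Poly V) (g : V → Poly W) p →
             substP g (substP f p) ≡ substP (substP g ∘ f) p
  substP-∘ f g (var v) = refl
  substP-∘ f g (con a) = refl
  substP-∘ f g (p ⊕ q) = cong₂ _⊕_ (substP-∘ f g p) (substP-∘ f g q)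
  substP-∘ f g (p ⊗ q) = cong₂ _⊗_ (substP-∘ f g p) (substP-∘ f g q)
  substP-∘ f g (⊝ p)   = cong ⊝_ (substP-∘ f g p)

  rename-comm : ∀ {U V W X : Set} {f : U → V} {g : V → X} {f′ : U → W} {g′ : W → X} →
                (∀ u → g (f u) ≡ g′ (f′ u)) →
                ∀ p → rename g (rename f p) ≡ rename g′ (rename f′ p)
  rename-comm {f = f} {g} {f′} {g′} square p = begin
    rename g (rename f p)     ≡⟨ substP-∘ _ _ p ⟩
    rename (g ∘ f) p          ≡⟨ substP-ext (cong var ∘ square) p ⟩
    rename (g′ ∘ f′) p        ≡⟨ substP-∘ _ _ p ⟨
    rename g′ (rename f′ p)   ∎
    where open ≡-Reasoning

module Monomials {c ℓ : Level} (k : Field c ℓ) where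
  open Polynomials k
  open Substitution k

  rename-suc-monomial-∷ʳ-outside : ∀ {n} (v : Subset n) →
    rename F.suc (monomial (v ∷ʳ outside)) ≡ rename inject₁ (rename F.suc (monomial v))
  monomial-∷ʳ-outside : ∀ {n} (v : Subset n) →
                        monomial (v ∷ʳ outside) ≡ rename inject₁ (monomial v)
  monomial-∷ʳ-outside []            = refl
  monomial-∷ʳ-outside (inside  ∷ v) = cong (var F.zero ⊗_) (rename-suc-monomial-∷ʳ-outside v)
  monomial-∷ʳ-outside (outside ∷ v) = rename-suc-monomial-∷ʳ-outside v

  rename-suc-monomial-∷ʳ-outside v = begin
    rename F.suc (monomial (v ∷ʳ outside))        ≡⟨ cong (rename F.suc) (monomial-∷ʳ-outside v) ⟩
    rename F.suc (rename inject₁ (monomial v))    ≡⟨ rename-comm (λ _ → refl) (monomial v) ⟩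
    rename inject₁ (rename F.suc (monomial v))    ∎
    where open ≡-Reasoning

module ToricInclusion {c ℓ : Level} (k : Field c ℓ) where
  open Toric k
  open Substitution k
  open Monomials k

  InToric-rename : ∀ {m n} {C : Code m} {D : Code n}
    (ι : CodeStar C → CodeStar D) (j : Fin m → Fin n) →
    (∀ y → monomial (proj₁ (ι y)) ≡ rename j (monomial (proj₁ y))) →
    ∀ f → InToric C f → InToric D (rename ι f)
  InToric-rename {C = C} {D} ι j monomial-ι f f∈T =
    subst (_≈P con _) (φ-rename-inclusion) (substP-cong (var ∘ j) f∈T)
    where
    open ≡-Reasoning
    φ-rename-inclusion : rename j (φ C f) ≡ φ D (rename ι f)
    φ-rename-inclusion = begin
      rename j (φ C f)                       ≡⟨ substP-∘ _ _ f ⟩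
      substP (rename j ∘ monomial ∘ proj₁) f  ≡⟨ substP-ext (λ y → monomial-ι y) f ⟨
      substP (monomial ∘ proj₁ ∘ ι) f         ≡⟨ substP-∘ _ _ f ⟨
      φ D (rename ι f)                        ∎

  InToric-inclStar : ∀ {n} (C : Code n) l s t f →
    InToric C f → InToric (piercing C l s t) (rename (inclStar C l s t) f)
  InToric-inclStar C l s t =
    InToric-rename (inclStar C l s t) inject₁ (λ { (v , _ , _) → monomial-∷ʳ-outside v })

corollary4p6 : {c ℓ : Level} (k : Field c ℓ) (n : ℕ) (C : Code n)
    (l s t : Subset n) → IsPartition l s t → Pierceable C l s t →
    (f : Toric.Poly k (CodeStar C)) → Toric.InToric k C f →
    Toric.InToric k (piercing C l s t) (Toric.rename k (inclStar C l s t) f)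
corollary4p6 k n C l s t _ _ = ToricInclusion.InToric-inclStar k C l s t
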